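{- Let $\mathbf{B}$ be a topological Boolean algebra, $\nabla$ an open filter and $\Delta$ a closed ideal of $\mathbf{B}$, and $\mathbf{T}=Tw(\mathbf{B},\nabla,\Delta)$. Then (1) $\nabla_{\mathsf{G}}(\mathbf{T})=\nabla\cap\mathsf{G}(\mathbf{B})=\nabla\cap\Gamma(\mathbf{T})=\nabla\cap\Lambda(\mathbf{B},\nabla)$; (2) $\Delta_{\mathsf{G}}(\mathbf{T})=\Delta\cap\mathsf{G}(\mathbf{B})=\Delta\cap\Gamma(\mathbf{T})$.
   Context: A topological Boolean algebra (TBA) is an algebra $\mathbf{B}=\langle B;\vee,\wedge,\to,\bot,\Box\rangle$ whose reduct is a Boolean algebra (top $1$, $\neg a:=a\to\bot$) with $\Box 1=1$, $\Box(a\wedge b)=\Box a\wedge\Box b$, $\Box a\le a$, $\Box a\le\Box\Box a$; $\Diamond a:=\neg\Box\neg a$. $\mathsf{G}(\mathbf{B})=\{a\in B:\Box a=a\}$. A filter is open if closed under $\Box$; an ideal is closed if closed under $\Diamond$. $Tw(\mathbf{B},\nabla,\Delta)=\{(a,b)\in B\times B: a\vee b\in\nabla,\ a\wedge b\in\Delta\}$ (a subalgebra of the full twist-structure $\mathbf{B}^{\bowtie}$, whose operations are $(a,b)\vee(c,d)=(a\vee c,b\wedge d)$, $(a,b)\wedge(c,d)=(a\wedge c,b\vee d)$, $(a,b)\to(c,d)=(a\to c,a\wedge d)$, $\bot=(\bot,1)$, $\sim(a,b)=(b,a)$, $\Box(a,b)=(\Box a,\Diamond b)$, $\Diamond(a,b)=(\Diamond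 a,\Box b)$). For $\mathbf{T}=Tw(\mathbf{B},\nabla,\Delta)$: $\mathsf{G}_2(\mathbf{T})=\{(a,b)\in\mathbf{T}:\Box a=a,\ \Box b=b\}$, $\Gamma(\mathbf{T})=\pi_1(\mathsf{G}_2(\mathbf{T}))$ ($\pi_1$ first projection), $\Lambda(\mathbf{B},\nabla)=\{a\in\mathsf{G}(\mathbf{B}): a\vee\Box\neg a\in\nabla\}$, $\nabla_{\mathsf{G}}(\mathbf{T})=\{a\vee b:(a,b)\in\mathsf{G}_2(\mathbf{T})\}$, $\Delta_{\mathsf{G}}(\mathbf{T})=\{a\wedge b:(a,b)\in\mathsf{G}_2(\mathbf{T})\}$. -}

module Defs where

open import Level using (Level; _⊔_; suc)
open import Algebra.Lattice.Bundles using (BooleanAlgebra)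
open import Data.Product using (Σ; _×_; _,_)
open import Relation.Unary using (Pred; _∩_)

record TBA (c ℓ : Level) : Set (suc (c ⊔ ℓ)) where
  field
    boolAlg : BooleanAlgebra c ℓ
  open BooleanAlgebra boolAlg public
  infix 4 _≤_
  infixr 5 _⇒_
  _≤_ : Carrier → Carrier → Set ℓ
  a ≤ b = (a ∧ b) ≈ a
  _⇒_ : Carrier → Carrier → Carrier
  a ⇒ b = (¬ a) ∨ b
  field
    □       : Carrier → Carrier
    □-cong  : ∀ {a b} → a ≈ b → □ a ≈ □ b
    □-top   : □ ⊤ ≈ ⊤
    □-meet  : ∀ a b → □ (a ∧ b) ≈ (□ a ∧ □ b)
    □-defl  : ∀ a → □ a ≤ a
    □-4     : ∀ a → □ a ≤ □ (□ a)
  ◇ : Carrier → Carrier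
  ◇ a = ¬ (□ (¬ a))

module _ {c ℓ : Level} (B : TBA c ℓ) where
  open TBA B

  G : Pred Carrier ℓ
  G a = □ a ≈ a

  record IsFilter {p : Level} (F : Pred Carrier p) : Set (c ⊔ ℓ ⊔ p) where
    field
      top∈   : F ⊤
      up     : ∀ {a b} → F a → a ≤ b → F b
      meet∈  : ∀ {a b} → F a → F b → F (a ∧ b)

  record IsIdeal {p : Level} (I : Pred Carrier p) : Set (c ⊔ ℓ ⊔ p) where
    field
      bot∈   : I ⊥
      down   : ∀ {a b} → I b → a ≤ b → I a
      join∈  : ∀ {a b} → I a → I b → I (a ∨ b)

  record IsOpenFilter {p : Level} (F : Pred Carrier p) : Set (c ⊔ ℓ ⊔ p) where
    field
      isFilter : IsFilter F
      □-closed : ∀ {a} → F a → F (□ a)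

  record IsClosedIdeal {p : Level} (I : Pred Carrier p) : Set (c ⊔ ℓ ⊔ p) where
    field
      isIdeal  : IsIdeal I
      ◇-closed : ∀ {a} → I a → I (◇ a)

  module _ {p q : Level} (∇ : Pred Carrier p) (Δ : Pred Carrier q) where

    Tw : Pred (Carrier × Carrier) (p ⊔ q)
    Tw (a , b) = ∇ (a ∨ b) × Δ (a ∧ b)

    G₂ : Pred (Carrier × Carrier) (p ⊔ q ⊔ ℓ)
    G₂ (a , b) = Tw (a , b) × (□ a ≈ a × □ b ≈ b)

    -- Γ(T) = π₁(G₂(T))  (image taken up to the setoid equality ≈)
    Γ : Pred Carrier (c ⊔ p ⊔ q ⊔ ℓ)
    Γ x = Σ Carrier λ a → Σ Carrier λ b → G₂ (a , b) × x ≈ a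

    ∇G : Pred Carrier (c ⊔ p ⊔ q ⊔ ℓ)
    ∇G x = Σ Carrier λ a → Σ Carrier λ b → G₂ (a , b) × x ≈ (a ∨ b)

    ΔG : Pred Carrier (c ⊔ p ⊔ q ⊔ ℓ)
    ΔG x = Σ Carrier λ a → Σ Carrier λ b → G₂ (a , b) × x ≈ (a ∧ b)

  Λ : {p : Level} → Pred Carrier p → Pred Carrier (ℓ ⊔ p)
  Λ ∇ a = G a × ∇ (a ∨ □ (¬ a))

module Submission where

open import Defs
open import Level using (Level)
open import Data.Product using (_×_; _,_)
open import Relation.Unary using (Pred; _∩_; _⊆_; _≐_)
open import Relation.Unary.Properties using (≐-sym; ≐-trans)
import Algebra.Lattice.Properties.BooleanAlgebra as BooleanAlgebraProperties
import Relation.Binary.Lattice as OrderLattice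

-- Every open element x of ∇ (resp. Δ) is the first component of the open pair
-- (x , ⊥) (resp. (x , ⊤)) of the twist structure, while a pair of open elements
-- has an open join and an open meet, since open elements form a sublattice.

module _ {c ℓ : Level} (B : TBA c ℓ) where
  open TBA B
  open BooleanAlgebraProperties boolAlg
  open OrderLattice.Lattice ∨-∧-orderTheoreticLattice
    using (x≤x∨y; y≤x∨y; ∨-least; antisym; ≤-respˡ-≈)
    renaming (_≤_ to _⊑_)

  -- The library's lattice order x ⊑ y is x ≈ x ∧ y, the symmetric form of _≤_.
  □-mono : ∀ {a b} → a ⊑ b → □ a ⊑ □ b
  □-mono {a} {b} a⊑b = trans (□-cong a⊑b) (□-meet a b)

  G-resp-≈ : ∀ {a b} → a ≈ b → G B a → G B b
  G-resp-≈ a≈b □a≈a = trans (□-cong (sym a≈b)) (trans □a≈a a≈b)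

  G-∨ : ∀ {a b} → G B a → G B b → G B (a ∨ b)
  G-∨ {a} {b} □a≈a □b≈b = antisym (sym (□-defl (a ∨ b)))
    (∨-least (≤-respˡ-≈ □a≈a (□-mono (x≤x∨y a b)))
             (≤-respˡ-≈ □b≈b (□-mono (y≤x∨y a b))))

  G-∧ : ∀ {a b} → G B a → G B b → G B (a ∧ b)
  G-∧ {a} {b} □a≈a □b≈b = trans (□-meet a b) (∧-cong □a≈a □b≈b)

  G-⊥ : G B ⊥
  G-⊥ = trans (sym (□-defl ⊥)) (∧-zeroʳ (□ ⊥))

  ≈⇒≤ : ∀ {a b} → a ≈ b → a ≤ b
  ≈⇒≤ {a} a≈b = trans (∧-congˡ (sym a≈b)) (∧-idem a)

  module _ {p : Level} {∇ : Pred Carrier p} (isFilter : IsFilter B ∇) where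
    open IsFilter isFilter

    filter-resp-≈ : ∀ {a b} → a ≈ b → ∇ a → ∇ b
    filter-resp-≈ a≈b a∈∇ = up a∈∇ (≈⇒≤ a≈b)

    ∇∩G≐∇∩Λ : (∇ ∩ G B) ≐ (∇ ∩ Λ B ∇)
    ∇∩G≐∇∩Λ = (λ { {a} (a∈∇ , a∈G) → a∈∇ , a∈G , up a∈∇ (∧-absorbs-∨ a (□ (¬ a))) })
            , (λ { (a∈∇ , a∈G , _) → a∈∇ , a∈G })

  module _ {q : Level} {Δ : Pred Carrier q} (isIdeal : IsIdeal B Δ) where
    open IsIdeal isIdeal

    ideal-resp-≈ : ∀ {a b} → a ≈ b → Δ a → Δ b
    ideal-resp-≈ a≈b a∈Δ = down a∈Δ (≈⇒≤ (sym a≈b))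

  module _ {p q : Level} {∇ : Pred Carrier p} {Δ : Pred Carrier q}
    (isFilter : IsFilter B ∇) (isIdeal : IsIdeal B Δ) where
    open IsFilter isFilter using (top∈)
    open IsIdeal isIdeal using (bot∈)

    Γ⊆G : Γ B ∇ Δ ⊆ G B
    Γ⊆G (a , _ , (_ , □a≈a , _) , x≈a) = G-resp-≈ (sym x≈a) □a≈a

    ∇∩G⊆G₂-with-⊥ : ∀ {a} → (∇ ∩ G B) a → G₂ B ∇ Δ (a , ⊥)
    ∇∩G⊆G₂-with-⊥ {a} (a∈∇ , a∈G) =
      ( filter-resp-≈ isFilter (sym (∨-identityʳ a)) a∈∇
      , ideal-resp-≈ isIdeal (sym (∧-zeroʳ a)) bot∈ )
      , a∈G , G-⊥

    Δ∩G⊆G₂-with-⊤ : ∀ {a} → (Δ ∩ G B) a → G₂ B ∇ Δ (a , ⊤)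
    Δ∩G⊆G₂-with-⊤ {a} (a∈Δ , a∈G) =
      ( filter-resp-≈ isFilter (sym (∨-zeroʳ a)) top∈
      , ideal-resp-≈ isIdeal (sym (∧-identityʳ a)) a∈Δ )
      , a∈G , □-top

    ∇G≐∇∩G : ∇G B ∇ Δ ≐ (∇ ∩ G B)
    ∇G≐∇∩G =
        (λ { (a , b , ((a∨b∈∇ , _) , a∈G , b∈G) , x≈a∨b) →
               filter-resp-≈ isFilter (sym x≈a∨b) a∨b∈∇
             , G-resp-≈ (sym x≈a∨b) (G-∨ a∈G b∈G) })
      , (λ { {a} a∈∇∩G → a , ⊥ , ∇∩G⊆G₂-with-⊥ a∈∇∩G , sym (∨-identityʳ a) })

    ΔG≐Δ∩G : ΔG B ∇ Δ ≐ (Δ ∩ G B)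
    ΔG≐Δ∩G =
        (λ { (a , b , ((_ , a∧b∈Δ) , a∈G , b∈G) , x≈a∧b) →
               ideal-resp-≈ isIdeal (sym x≈a∧b) a∧b∈Δ
             , G-resp-≈ (sym x≈a∧b) (G-∧ a∈G b∈G) })
      , (λ { {a} a∈Δ∩G → a , ⊤ , Δ∩G⊆G₂-with-⊤ a∈Δ∩G , sym (∧-identityʳ a) })

    ∇∩G≐∇∩Γ : (∇ ∩ G B) ≐ (∇ ∩ Γ B ∇ Δ)
    ∇∩G≐∇∩Γ = (λ { {a} a∈∇∩G@(a∈∇ , _) → a∈∇ , a , ⊥ , ∇∩G⊆G₂-with-⊥ a∈∇∩G , refl })
            , (λ { (a∈∇ , a∈Γ) → a∈∇ , Γ⊆G a∈Γ })

    Δ∩G≐Δ∩Γ : (Δ ∩ G B) ≐ (Δ ∩ Γ B ∇ Δ)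
    Δ∩G≐Δ∩Γ = (λ { {a} a∈Δ∩G@(a∈Δ , _) → a∈Δ , a , ⊤ , Δ∩G⊆G₂-with-⊤ a∈Δ∩G , refl })
            , (λ { (a∈Δ , a∈Γ) → a∈Δ , Γ⊆G a∈Γ })

lemma3p1p2 : {c ℓ p q : Level} (B : TBA c ℓ)
    (∇ : Pred (TBA.Carrier B) p) (Δ : Pred (TBA.Carrier B) q) →
    IsOpenFilter B ∇ → IsClosedIdeal B Δ →
    ((∇G B ∇ Δ ≐ (∇ ∩ G B)) × ((∇ ∩ G B) ≐ (∇ ∩ Γ B ∇ Δ)) × ((∇ ∩ Γ B ∇ Δ) ≐ (∇ ∩ Λ B ∇)))
    × ((ΔG B ∇ Δ ≐ (Δ ∩ G B)) × ((Δ ∩ G B) ≐ (Δ ∩ Γ B ∇ Δ)))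
lemma3p1p2 B ∇ Δ openFilter closedIdeal =
    ( ∇G≐∇∩G B F I
    , ∇∩G≐∇∩Γ B F I
    , ≐-trans (≐-sym (∇∩G≐∇∩Γ B F I)) (∇∩G≐∇∩Λ B F) )
  , ( ΔG≐Δ∩G B F I
    , Δ∩G≐Δ∩Γ B F I )
  where
    F : IsFilter B ∇
    F = IsOpenFilter.isFilter openFilter
    I : IsIdeal B Δ
    I = IsClosedIdeal.isIdeal closedIdeal
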